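{- Let $\mathcal{F}$ be a Ferrers diagram, let $r\in\mathbb{N}$, and let $P=\{(\Delta_{i_1}\cap\mathcal{F})_{j_1},\ldots,(\Delta_{i_r}\cap\mathcal{F})_{j_r}\}\in\mathrm{NAR}(\mathcal{F},r)$ with $(i_1,j_1)<_{\mathrm{lex}}\cdots<_{\mathrm{lex}}(i_r,j_r)$. Then $P\setminus\{(\Delta_{i_r}\cap\mathcal{F})_{j_r}\}\in\mathrm{NAR}(\Pi(\mathcal{F},i_r,j_r),r-1)$, up to realigning the cells as in the definition of the reduction (i.e., the cells of $P\setminus\{(\Delta_{i_r}\cap\mathcal{F})_{j_r}\}$ are not removed when forming $\Pi(\mathcal{F},i_r,j_r)$, and their images under the realignment form a placement of $r-1$ non-attacking rooks on $\Pi(\mathcal{F},i_r,j_r)$).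
   Context: $\mathbb{N}$ denotes the positive integers; a cell $(i,j)$ lies in row $i$, column $j$. A Ferrers diagram is a finite set $\mathcal{F}\subseteq\mathbb{N}\times\mathbb{N}$ such that $(i,j)\in\mathcal{F}$ implies $(s,t)\in\mathcal{F}$ for all $1\le s\le i$, $1\le t\le j$. The $i$-th diagonal is $\Delta_i=\{(s,i-s+1):s\in\{1,\ldots,i\}\}$. For $i\in\mathbb{N}$ and $1\le j\le|\Delta_i\cap\mathcal{F}|$, $(\Delta_i\cap\mathcal{F})_j$ denotes the $j$-th element of $\Delta_i\cap\mathcal{F}$ counted starting from the top-most row; cells of $\mathcal{F}$ are ordered by the lexicographic order $<_{\mathrm{lex}}$ on their labels $(i,j)$. A placement of non-attacking rooks is a set of cells no two sharing a row or a column; $\mathrm{NAR}(\mathcal{F},r)$ is the set of such placements contained in $\mathcal{F}$ with $r$ elements. For $P\subseteq\mathbb{N}\times\mathbb{N}$, $\mathrm{ATK}(P)=\bigcup_{(a,b)\in P}\big(\{(s,b):1\le s\le a\}\cup\{(a,t):1\le t\le b\}\big)$. The reduction $\Pi(\mathcal{F},i,j)$ is the Ferrers diagram obtained from $\mathcal{F}$ by removing the set $\mathrm{ATK}(\{(\Delta_i\cap\mathcal{F})_j\})\cup\{(\Delta_s\cap\mathcal{F})_t : (i,j)<_{\mathrm{lex}}(s,t)\}$ and then aligning the remaining cells to the top and then to the left. -}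

module Defs where

open import Data.Nat using (ℕ; zero; suc; _+_; _∸_; _≤_; _<_; _≤ᵇ_; _<ᵇ_; _≡ᵇ_)
open import Data.Bool using (Bool; true; false; _∧_; _∨_; not; if_then_else_)
open import Data.Product using (_×_; _,_; proj₁; proj₂)
open import Data.Sum using (_⊎_)
open import Data.List using (List; []; _∷_; map; upTo; filterᵇ; length)
open import Data.Maybe using (Maybe; just; nothing)
open import Relation.Binary.PropositionalEquality using (_≡_)

-- A cell (i , j) : row i, column j (positive integers, 1-based).
Cell : Set
Cell = ℕ × ℕ

record Ferrers : Set where
  field
    mem     : ℕ → ℕ → Bool
    bound   : ℕ
    pos     : ∀ i j → mem i j ≡ true → (1 ≤ i) × (1 ≤ j)
    bounded : ∀ i j → mem i j ≡ true → (i ≤ bound) × (j ≤ bound)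
    closed  : ∀ i j s t → mem i j ≡ true → 1 ≤ s → s ≤ i → 1 ≤ t → t ≤ j
              → mem s t ≡ true
open Ferrers public

-- Δ_i ∩ F, listed from the top-most row downward:
-- Δ_i = {(s , i - s + 1) : s = 1..i}; for k = s - 1 the column is i ∸ k.
diag : Ferrers → ℕ → List Cell
diag F i = filterᵇ (λ c → mem F (proj₁ c) (proj₂ c))
                   (map (λ k → (suc k , i ∸ k)) (upTo i))

-- 1-based list lookup
nth : {A : Set} → List A → ℕ → Maybe A
nth []       _             = nothing
nth (x ∷ xs) zero          = nothing
nth (x ∷ xs) (suc zero)    = just x
nth (x ∷ xs) (suc (suc n)) = nth xs (suc n)

diagCell : Ferrers → ℕ → ℕ → Maybe Cell
diagCell F i j = nth (diag F i) j

_<lex_ : ℕ × ℕ → ℕ × ℕ → Set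
(i , j) <lex (s , t) = (i < s) ⊎ ((i ≡ s) × (j < t))

_<lexᵇ_ : ℕ × ℕ → ℕ × ℕ → Bool
(i , j) <lexᵇ (s , t) = (i <ᵇ s) ∨ ((i ≡ᵇ s) ∧ (j <ᵇ t))

-- label (d , p) of a cell x ∈ F: x = (Δ_d ∩ F)_p, where d = row + col - 1 and
-- p is the position of x in Δ_d ∩ F counted from the top.
labelOf : Ferrers → Cell → ℕ × ℕ
labelOf F (s , t) =
  (s + t ∸ 1 , length (filterᵇ (λ y → proj₁ y ≤ᵇ s) (diag F (s + t ∸ 1))))

attackedBy : Cell → Cell → Bool
attackedBy (a , b) (s , t) = ((t ≡ᵇ b) ∧ (s ≤ᵇ a)) ∨ ((s ≡ᵇ a) ∧ (t ≤ᵇ b))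

-- cells of F not removed when forming Π(F,i,j), i.e. cells of
-- F ∖ (ATK({(Δ_i∩F)_j}) ∪ {(Δ_s∩F)_t : (i,j) <lex (s,t)})
kept : Ferrers → ℕ → ℕ → Cell → Bool
kept F i j x with diagCell F i j
... | just c  = mem F (proj₁ x) (proj₂ x) ∧ not (attackedBy c x)
                ∧ not ((i , j) <lexᵇ labelOf F x)
... | nothing = mem F (proj₁ x) (proj₂ x) ∧ not ((i , j) <lexᵇ labelOf F x)

countUpTo : (ℕ → Bool) → ℕ → ℕ
countUpTo f zero    = 0
countUpTo f (suc n) = countUpTo f n + (if f (suc n) then 1 else 0)

-- height of column t after aligning the kept cells to the top
colHeight : Ferrers → ℕ → ℕ → ℕ → ℕ
colHeight F i j t = countUpTo (λ s → kept F i j (s , t)) (bound F)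

topAligned : Ferrers → ℕ → ℕ → Cell → Bool
topAligned F i j (s , t) = (1 ≤ᵇ s) ∧ (s ≤ᵇ colHeight F i j t)

-- length of row s after then aligning to the left
rowLength : Ferrers → ℕ → ℕ → ℕ → ℕ
rowLength F i j s = countUpTo (λ t → topAligned F i j (s , t)) (bound F)

inΠ : Ferrers → ℕ → ℕ → Cell → Bool
inΠ F i j (s , u) = (1 ≤ᵇ s) ∧ (1 ≤ᵇ u) ∧ (u ≤ᵇ rowLength F i j s)

-- image of a kept cell (s , t) under the realignment:
-- top-alignment sends it to (s' , t) with s' = #kept cells of column t in rows ≤ s;
-- left-alignment then sends (s' , t) to (s' , t') with
-- t' = #top-aligned cells of row s' in columns ≤ t.
realign : Ferrers → ℕ → ℕ → Cell → Cell
realign F i j (s , t) =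
  let s' = countUpTo (λ x → kept F i j (x , t)) s in
  (s' , countUpTo (λ y → topAligned F i j (s' , y)) t)

-- A rook (Δ_{i'} ∩ F)_{j'} with (i',j') <lex (i,j) survives the reduction Π(F,i,j): it shares
-- no line with the last rook (p,q) = (Δ_i ∩ F)_j and its label is not later. All of row p and
-- column q is removed (cells left of or above (p,q) are attacked, the others lie on later
-- diagonals), while the other kept cells are closed under moving up or left within rows ≠ p and
-- columns ≠ q. Hence top-alignment sends row s to s or s - 1 according as s < p or s > p, and
-- left-alignment does the same to columns relative to q. Both maps are injective away from p
-- (resp. q), so the realigned rooks remain non-attacking, and they land inside Π(F,i,j).
module Submission where

open import Defs
open import Data.Nat using (ℕ; zero; suc; _+_; _∸_; _≤_; _<_; _≤ᵇ_; _≡ᵇ_; z≤n; s≤s; s≤s⁻¹; _≟_; _≤?_)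
open import Data.Nat.Properties
open import Data.Bool using (Bool; true; false; _∧_; not; T; T?; if_then_else_)
open import Data.Bool.Properties using (T-≡; T-∨; T-∧; ¬-not; ∨-zeroʳ; ∧-zeroʳ)
open import Data.Fin using (Fin; fromℕ; inject₁)
open import Data.Fin as Fin using ()
open import Data.Fin.Properties using (fromℕ≢inject₁; inject₁-injective; ≤fromℕ)
import Data.Fin.Properties as Finₚ
open import Data.List using (List; []; _∷_; map; applyUpTo; filterᵇ; length)
open import Data.List.Relation.Unary.All using (All; []; _∷_)
open import Data.List.Relation.Unary.All.Properties using (map⁺; applyUpTo⁺₁; filter⁺; all-filter)
open import Data.Maybe using (just)
open import Data.Product using (_×_; _,_; proj₁; proj₂; uncurry)
open import Data.Sum using (inj₁; inj₂)
open import Data.Unit using (⊤; tt)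
open import Function using (_∘_; id; Equivalence)
open import Relation.Binary.PropositionalEquality using (_≡_; _≢_; refl; sym; trans; cong; subst)
open import Relation.Nullary using (¬_; yes; no; contradiction)

T⇒≡true : ∀ {b} → T b → b ≡ true
T⇒≡true = Equivalence.to T-≡

≡true⇒T : ∀ {b} → b ≡ true → T b
≡true⇒T = Equivalence.from T-≡

∧-true : ∀ {a b} → a ≡ true → b ≡ true → a ∧ b ≡ true
∧-true refl refl = refl

∧-not-not-true : ∀ {a b d} → a ∧ not b ∧ not d ≡ true → a ≡ true × b ≡ false × d ≡ false
∧-not-not-true {true} {false} {false} _ = refl , refl , refl
∧-not-not-true {true} {true} ()
∧-not-not-true {true} {false} {true} ()
∧-not-not-true {false} ()

≡ᵇ-≢ : ∀ {m n} → m ≢ n → (m ≡ᵇ n) ≡ false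
≡ᵇ-≢ {m} {n} m≢n = ¬-not (m≢n ∘ ≡ᵇ⇒≡ m n ∘ ≡true⇒T)

≤⇒≤ᵇ-true : ∀ {m n} → m ≤ n → (m ≤ᵇ n) ≡ true
≤⇒≤ᵇ-true = T⇒≡true ∘ ≤⇒≤ᵇ

≤ᵇ-zero : ∀ {n} → 1 ≤ n → (n ≤ᵇ 0) ≡ false
≤ᵇ-zero {suc n} _ = refl

<lexᵇ⇒<lex : ∀ a b → T (a <lexᵇ b) → a <lex b
<lexᵇ⇒<lex (i , j) (d , e) lt with Equivalence.to T-∨ lt
... | inj₁ i<d = inj₁ (<ᵇ⇒< i d i<d)
... | inj₂ i≡d∧j<e with Equivalence.to T-∧ i≡d∧j<e
...   | i≡d , j<e = inj₂ (≡ᵇ⇒≡ i d i≡d , <ᵇ⇒< j e j<e)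

<lex-asym : ∀ {a b} → a <lex b → ¬ b <lex a
<lex-asym (inj₁ i<d) (inj₁ d<i) = <-asym i<d d<i
<lex-asym (inj₁ i<d) (inj₂ (refl , _)) = <-irrefl refl i<d
<lex-asym (inj₂ (refl , _)) (inj₁ d<i) = <-irrefl refl d<i
<lex-asym (inj₂ (refl , j<e)) (inj₂ (refl , e<j)) = <-asym j<e e<j

<lex⇒¬>lexᵇ : ∀ {a b} → a <lex b → (b <lexᵇ a) ≡ false
<lex⇒¬>lexᵇ {a} {b} a<b = ¬-not (<lex-asym a<b ∘ <lexᵇ⇒<lex b a ∘ ≡true⇒T)

<⇒<lexᵇ : ∀ {i j d e} → i < d → ((i , j) <lexᵇ (d , e)) ≡ true
<⇒<lexᵇ i<d rewrite T⇒≡true (<⇒<ᵇ i<d) = refl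

¬<lexᵇ⇒≥ : ∀ a b → (a <lexᵇ b) ≡ false → proj₁ b ≤ proj₁ a
¬<lexᵇ⇒≥ (i , j) (d , e) later≡false =
  ≮⇒≥ λ i<d → contradiction (trans (sym later≡false) (<⇒<lexᵇ {j = j} {e = e} i<d)) λ ()

attackedBy-sameRow : ∀ {a b t} → t ≤ b → attackedBy (a , b) (a , t) ≡ true
attackedBy-sameRow {a} t≤b rewrite T⇒≡true (≡⇒≡ᵇ a a refl) | T⇒≡true (≤⇒≤ᵇ t≤b) = ∨-zeroʳ _

attackedBy-sameColumn : ∀ {a b s} → s ≤ a → attackedBy (a , b) (s , b) ≡ true
attackedBy-sameColumn {b = b} s≤a rewrite T⇒≡true (≡⇒≡ᵇ b b refl) | T⇒≡true (≤⇒≤ᵇ s≤a) = refl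

attackedBy-elsewhere : ∀ {a b s t} → s ≢ a → t ≢ b → attackedBy (a , b) (s , t) ≡ false
attackedBy-elsewhere s≢a t≢b rewrite ≡ᵇ-≢ s≢a | ≡ᵇ-≢ t≢b = refl

RowsAscendingFrom : ℕ → List Cell → Set
RowsAscendingFrom m []       = ⊤
RowsAscendingFrom m (x ∷ xs) = m < proj₁ x × RowsAscendingFrom (proj₁ x) xs

RowsAscendingFrom-weaken : ∀ {m m'} xs → m' ≤ m → RowsAscendingFrom m xs → RowsAscendingFrom m' xs
RowsAscendingFrom-weaken []       _    _           = tt
RowsAscendingFrom-weaken (x ∷ xs) m'≤m (m<x , asc) = ≤-<-trans m'≤m m<x , asc

RowsAscendingFrom-filter : ∀ (f : Cell → Bool) {m} xs →
  RowsAscendingFrom m xs → RowsAscendingFrom m (filterᵇ f xs)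
RowsAscendingFrom-filter f []       _ = tt
RowsAscendingFrom-filter f (x ∷ xs) (m<x , asc) with f x
... | true  = m<x , RowsAscendingFrom-filter f xs asc
... | false = RowsAscendingFrom-weaken (filterᵇ f xs) (<⇒≤ m<x) (RowsAscendingFrom-filter f xs asc)

antidiagonal-ascending : ∀ i (g : ℕ → ℕ) n {m} → m ≤ g 0 → (∀ k → g k < g (suc k)) →
  RowsAscendingFrom m (map (λ k → (suc k , i ∸ k)) (applyUpTo g n))
antidiagonal-ascending i g zero    _    _  = tt
antidiagonal-ascending i g (suc n) m≤g0 g< =
  s≤s m≤g0 , antidiagonal-ascending i (g ∘ suc) n (g< 0) (g< ∘ suc)

nth-row> : ∀ {m} xs j {x} → RowsAscendingFrom m xs → nth xs j ≡ just x → m < proj₁ x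
nth-row> (y ∷ xs) (suc zero)    (m<y , _)   refl = m<y
nth-row> (y ∷ xs) (suc (suc j)) (m<y , asc) e    = <-trans m<y (nth-row> xs (suc j) asc e)

filter-rows≤-empty : ∀ {m n} xs → RowsAscendingFrom m xs → n ≤ m →
  filterᵇ (λ y → proj₁ y ≤ᵇ n) xs ≡ []
filter-rows≤-empty []       _           _   = refl
filter-rows≤-empty {n = n} (x ∷ xs) (m<x , asc) n≤m with proj₁ x ≤ᵇ n in x≤n
... | true  = contradiction (≤ᵇ⇒≤ _ _ (≡true⇒T x≤n)) (<⇒≱ (≤-<-trans n≤m m<x))
... | false = filter-rows≤-empty xs asc (≤-trans n≤m (<⇒≤ m<x))

nth-rank : ∀ {m} xs j {x} → RowsAscendingFrom m xs → nth xs j ≡ just x →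
  length (filterᵇ (λ y → proj₁ y ≤ᵇ proj₁ x) xs) ≡ j
nth-rank (y ∷ xs) (suc zero) (_ , asc) refl
  rewrite T⇒≡true (≤⇒≤ᵇ (≤-refl {proj₁ y})) = cong (suc ∘ length) (filter-rows≤-empty xs asc ≤-refl)
nth-rank (y ∷ xs) (suc (suc j)) (_ , asc) e
  rewrite T⇒≡true (≤⇒≤ᵇ (<⇒≤ (nth-row> xs (suc j) asc e))) = cong suc (nth-rank xs (suc j) asc e)

All-nth : ∀ {P : Cell → Set} {xs j x} → All P xs → nth xs j ≡ just x → P x
All-nth {xs = _ ∷ _} {suc zero}    (px ∷ _)   refl = px
All-nth {xs = _ ∷ _} {suc (suc j)} (_  ∷ pxs) e    = All-nth {j = suc j} pxs e

diagCell-mem : ∀ {F i j x} → diagCell F i j ≡ just x → mem F (proj₁ x) (proj₂ x) ≡ true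
diagCell-mem {F} {i} e = T⇒≡true (All-nth (all-filter inF? antidiagonal) e)
  where
  inF? = λ (c : Cell) → T? (mem F (proj₁ c) (proj₂ c))
  antidiagonal = map (λ k → (suc k , i ∸ k)) (applyUpTo id i)

diagCell-sum : ∀ {F i j x} → diagCell F i j ≡ just x → proj₁ x + proj₂ x ≡ suc i
diagCell-sum {F} {i} e = All-nth (filter⁺ (λ c → T? (mem F (proj₁ c) (proj₂ c))) sums) e
  where
  sums : All (λ c → proj₁ c + proj₂ c ≡ suc i) (map (λ k → (suc k , i ∸ k)) (applyUpTo id i))
  sums = map⁺ (applyUpTo⁺₁ id i λ k<i → cong suc (m+[n∸m]≡n (<⇒≤ k<i)))

labelOf-diagCell : ∀ {F i j s t} → diagCell F i j ≡ just (s , t) → labelOf F (s , t) ≡ (i , j)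
labelOf-diagCell {F} {i} {j} e rewrite diagCell-sum {F} {i} {j} e =
  cong (i ,_) (nth-rank (diag F i) j diag-ascending e)
  where
  diag-ascending : RowsAscendingFrom 0 (diag F i)
  diag-ascending = RowsAscendingFrom-filter _ _ (antidiagonal-ascending i id i z≤n n<1+n)

-- Rank p s c : c is the position of s in the sequence 1, 2, … with p deleted
-- (for s = p, the position p ∸ 1 of its predecessor).
data Rank (p : ℕ) : ℕ → ℕ → Set where
  below : ∀ {s} → s < p → Rank p s s
  above : ∀ {c} → p ≤ suc c → Rank p (suc c) c

Rank-suc : ∀ {p n c} → Rank p n c → suc n ≢ p → Rank p (suc n) (suc c)
Rank-suc (below n<p) 1+n≢p = below (≤∧≢⇒< n<p 1+n≢p)
Rank-suc (above p≤1+c) _   = above (m≤n⇒m≤1+n p≤1+c)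

Rank-gap : ∀ {p n c} → Rank p n c → suc n ≡ p → Rank p (suc n) c
Rank-gap (below _)     refl = above ≤-refl
Rank-gap (above p≤1+c) refl = contradiction p≤1+c (<⇒≱ ≤-refl)

Rank-injective : ∀ {p s s' c c'} → Rank p s c → Rank p s' c' → s ≢ p → s' ≢ p → c ≡ c' → s ≡ s'
Rank-injective (below _)   (below _)   _   _    refl = refl
Rank-injective (above _)   (above _)   _   _    refl = refl
Rank-injective (below s<p) (above p≤s') _  s'≢p refl =
  contradiction (s≤s⁻¹ (≤∧≢⇒< p≤s' (s'≢p ∘ sym))) (<⇒≱ s<p)
Rank-injective (above p≤s) (below s'<p) s≢p _  refl =
  contradiction (s≤s⁻¹ (≤∧≢⇒< p≤s (s≢p ∘ sym))) (<⇒≱ s'<p)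

countUpTo-true : ∀ (f : ℕ → Bool) n → f (suc n) ≡ true → countUpTo f (suc n) ≡ suc (countUpTo f n)
countUpTo-true f n fn≡true rewrite fn≡true = +-comm _ 1

countUpTo-false : ∀ (f : ℕ → Bool) n → f (suc n) ≡ false → countUpTo f (suc n) ≡ countUpTo f n
countUpTo-false f n fn≡false rewrite fn≡false = +-identityʳ _

countUpTo-rank : ∀ (f : ℕ → Bool) {p} → 1 ≤ p → f p ≡ false →
  ∀ s → (∀ x → 1 ≤ x → x ≤ s → x ≢ p → f x ≡ true) → Rank p s (countUpTo f s)
countUpTo-rank f 1≤p _ zero _ = below 1≤p
countUpTo-rank f {p} 1≤p fp≡false (suc n) true-off-p
  with countUpTo-rank f 1≤p fp≡false n (λ x 1≤x x≤n → true-off-p x 1≤x (m≤n⇒m≤1+n x≤n)) | suc n ≟ p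
... | rank | yes refl = subst (Rank p (suc n)) (sym (countUpTo-false f n fp≡false)) (Rank-gap rank refl)
... | rank | no 1+n≢p =
  subst (Rank p (suc n)) (sym (countUpTo-true f n (true-off-p (suc n) (s≤s z≤n) ≤-refl 1+n≢p)))
        (Rank-suc rank 1+n≢p)

countUpTo-pos : ∀ (f : ℕ → Bool) {s} → 1 ≤ s → f s ≡ true → 1 ≤ countUpTo f s
countUpTo-pos f {suc n} _ fs≡true rewrite countUpTo-true f n fs≡true = s≤s z≤n

countUpTo-none : ∀ (f : ℕ → Bool) n → (∀ x → f x ≡ false) → countUpTo f n ≡ 0
countUpTo-none f zero    _        = refl
countUpTo-none f (suc n) all-false rewrite all-false (suc n) =
  trans (+-identityʳ _) (countUpTo-none f n all-false)

countUpTo-monoˡ : ∀ (f g : ℕ → Bool) n → (∀ x → 1 ≤ x → x ≤ n → f x ≡ true → g x ≡ true) →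
  countUpTo f n ≤ countUpTo g n
countUpTo-monoˡ f g zero    _   = z≤n
countUpTo-monoˡ f g (suc n) f⇒g =
  +-mono-≤ (countUpTo-monoˡ f g n λ x 1≤x x≤n → f⇒g x 1≤x (m≤n⇒m≤1+n x≤n))
           (indicator-mono (f⇒g (suc n) (s≤s z≤n) ≤-refl))
  where
  indicator-mono : ∀ {a b : Bool} → (a ≡ true → b ≡ true) → (if a then 1 else 0) ≤ (if b then 1 else 0)
  indicator-mono {false} _   = z≤n
  indicator-mono {true}  a⇒b rewrite a⇒b refl = ≤-refl

countUpTo-monoʳ : ∀ (f : ℕ → Bool) {m n} → m ≤ n → countUpTo f m ≤ countUpTo f n
countUpTo-monoʳ f {n = zero}  z≤n = ≤-refl
countUpTo-monoʳ f {n = suc n} m≤1+n with m≤n⇒m<n∨m≡n m≤1+n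
... | inj₂ refl      = ≤-refl
... | inj₁ (s≤s m≤n) = ≤-trans (countUpTo-monoʳ f m≤n) (m≤m+n _ _)

module Reduction (F : Ferrers) (i j : ℕ) {p q : ℕ} (pq∈Δ : diagCell F i j ≡ just (p , q)) where

  kept-unfold : ∀ x → kept F i j x
    ≡ mem F (proj₁ x) (proj₂ x) ∧ not (attackedBy (p , q) x) ∧ not ((i , j) <lexᵇ labelOf F x)
  kept-unfold x rewrite pq∈Δ = refl

  kept-intro : ∀ {x} → mem F (proj₁ x) (proj₂ x) ≡ true → attackedBy (p , q) x ≡ false →
    ((i , j) <lexᵇ labelOf F x) ≡ false → kept F i j x ≡ true
  kept-intro {x} x∈F unattacked not-later rewrite kept-unfold x | x∈F | unattacked | not-later = refl

  kept-elim : ∀ {x} → kept F i j x ≡ true →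
    mem F (proj₁ x) (proj₂ x) ≡ true × attackedBy (p , q) x ≡ false × ((i , j) <lexᵇ labelOf F x) ≡ false
  kept-elim {x} k =
    ∧-not-not-true {mem F (proj₁ x) (proj₂ x)} {attackedBy (p , q) x} {(i , j) <lexᵇ labelOf F x}
                   (trans (sym (kept-unfold x)) k)

  kept⇒mem : ∀ {x} → kept F i j x ≡ true → mem F (proj₁ x) (proj₂ x) ≡ true
  kept⇒mem = proj₁ ∘ kept-elim

  kept⇒unattacked : ∀ {x} → kept F i j x ≡ true → attackedBy (p , q) x ≡ false
  kept⇒unattacked = proj₁ ∘ proj₂ ∘ kept-elim

  kept⇒not-later : ∀ {x} → kept F i j x ≡ true → ((i , j) <lexᵇ labelOf F x) ≡ false
  kept⇒not-later = proj₂ ∘ proj₂ ∘ kept-elim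

  -- (s , t) lies on Δ_{s+t-1}
  kept⇒diagonal≤ : ∀ {s t} → kept F i j (s , t) ≡ true → s + t ≤ suc i
  kept⇒diagonal≤ {zero}  {t} k with proj₁ (pos F zero t (kept⇒mem k))
  ... | ()
  kept⇒diagonal≤ {suc s} {t} k = s≤s (¬<lexᵇ⇒≥ (i , j) (labelOf F (suc s , t)) (kept⇒not-later k))

  diagonal<⇒not-later : ∀ {x y} → 1 ≤ x → x + y ≤ i → ((i , j) <lexᵇ labelOf F (x , y)) ≡ false
  diagonal<⇒not-later {suc x} {y} _ x+y<i = <lex⇒¬>lexᵇ {a = labelOf F (suc x , y)} (inj₁ x+y<i)

  pq∈F : mem F p q ≡ true
  pq∈F = diagCell-mem {F} {i} {j} pq∈Δ

  1≤p : 1 ≤ p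
  1≤p = proj₁ (pos F p q pq∈F)

  1≤q : 1 ≤ q
  1≤q = proj₂ (pos F p q pq∈F)

  p+q≡1+i : p + q ≡ suc i
  p+q≡1+i = diagCell-sum {F} {i} {j} pq∈Δ

  row-removed : ∀ t → kept F i j (p , t) ≡ false
  row-removed t = ¬-not kept-impossible
    where
    kept-impossible : kept F i j (p , t) ≢ true
    kept-impossible k with t ≤? q
    ... | yes t≤q = contradiction (trans (sym (attackedBy-sameRow {p} {q} t≤q)) (kept⇒unattacked k)) λ ()
    ... | no  t≰q = <⇒≱ (+-monoʳ-< p (≰⇒> t≰q)) (subst (p + t ≤_) (sym p+q≡1+i) (kept⇒diagonal≤ k))

  column-removed : ∀ s → kept F i j (s , q) ≡ false
  column-removed s = ¬-not kept-impossible
    where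
    kept-impossible : kept F i j (s , q) ≢ true
    kept-impossible k with s ≤? p
    ... | yes s≤p = contradiction (trans (sym (attackedBy-sameColumn {p} {q} s≤p)) (kept⇒unattacked k)) λ ()
    ... | no  s≰p = <⇒≱ (+-monoˡ-< q (≰⇒> s≰p)) (subst (s + q ≤_) (sym p+q≡1+i) (kept⇒diagonal≤ k))

  kept⇒row≢ : ∀ {s t} → kept F i j (s , t) ≡ true → s ≢ p
  kept⇒row≢ {t = t} k refl = contradiction (trans (sym k) (row-removed t)) λ ()

  kept⇒column≢ : ∀ {s t} → kept F i j (s , t) ≡ true → t ≢ q
  kept⇒column≢ {s} k refl = contradiction (trans (sym k) (column-removed s)) λ ()

  kept-closed : ∀ {s t x y} → kept F i j (s , t) ≡ true → 1 ≤ x → x ≤ s → 1 ≤ y → y ≤ t →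
    x ≢ p → y ≢ q → kept F i j (x , y) ≡ true
  kept-closed {s} {t} {x} {y} k 1≤x x≤s 1≤y y≤t x≢p y≢q =
    kept-intro (closed F s t x y (kept⇒mem k) 1≤x x≤s 1≤y y≤t) (attackedBy-elsewhere x≢p y≢q) not-later
    where
    earlier-diagonal : x + y < s + t → ((i , j) <lexᵇ labelOf F (x , y)) ≡ false
    earlier-diagonal lt = diagonal<⇒not-later 1≤x (s≤s⁻¹ (<-≤-trans lt (kept⇒diagonal≤ k)))

    not-later : ((i , j) <lexᵇ labelOf F (x , y)) ≡ false
    not-later with m≤n⇒m<n∨m≡n x≤s | m≤n⇒m<n∨m≡n y≤t
    ... | inj₂ refl | inj₂ refl = kept⇒not-later k
    ... | inj₁ x<s  | _         = earlier-diagonal (+-mono-<-≤ x<s y≤t)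
    ... | inj₂ refl | inj₁ y<t  = earlier-diagonal (+-monoʳ-< x y<t)

  earlier-kept : ∀ {i' j' s t} → diagCell F i' j' ≡ just (s , t) → (i' , j') <lex (i , j) →
    s ≢ p → t ≢ q → kept F i j (s , t) ≡ true
  earlier-kept {i'} {j'} st∈Δ earlier s≢p t≢q =
    kept-intro (diagCell-mem {F} {i'} {j'} st∈Δ) (attackedBy-elsewhere s≢p t≢q)
      (subst (λ L → ((i , j) <lexᵇ L) ≡ false) (sym (labelOf-diagCell {F} {i'} {j'} st∈Δ))
             (<lex⇒¬>lexᵇ earlier))

  kept⇒pos : ∀ {s t} → kept F i j (s , t) ≡ true → 1 ≤ s × 1 ≤ t
  kept⇒pos {s} {t} k = pos F s t (kept⇒mem k)

  kept⇒bounded : ∀ {s t} → kept F i j (s , t) ≡ true → s ≤ bound F × t ≤ bound F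
  kept⇒bounded {s} {t} k = bounded F s t (kept⇒mem k)

  realigned-row≥1 : ∀ {s t} → kept F i j (s , t) ≡ true → 1 ≤ proj₁ (realign F i j (s , t))
  realigned-row≥1 {s} {t} k = countUpTo-pos (λ x → kept F i j (x , t)) (proj₁ (kept⇒pos k)) k

  row-rank : ∀ {s t} → kept F i j (s , t) ≡ true → Rank p s (proj₁ (realign F i j (s , t)))
  row-rank {s} {t} k = countUpTo-rank (λ x → kept F i j (x , t)) 1≤p (row-removed t) s
    λ x 1≤x x≤s x≢p → kept-closed k 1≤x x≤s (proj₂ (kept⇒pos k)) ≤-refl x≢p (kept⇒column≢ k)

  topAligned-rowPrefix : ∀ {s t y} → kept F i j (s , t) ≡ true → 1 ≤ y → y ≤ t → y ≢ q →
    topAligned F i j (proj₁ (realign F i j (s , t)) , y) ≡ true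
  topAligned-rowPrefix {s} {t} {y} k 1≤y y≤t y≢q =
    ∧-true (≤⇒≤ᵇ-true (realigned-row≥1 k))
           (≤⇒≤ᵇ-true (≤-trans shorter-column (countUpTo-monoʳ _ (proj₁ (kept⇒bounded k)))))
    where
    shorter-column : countUpTo (λ x → kept F i j (x , t)) s ≤ countUpTo (λ x → kept F i j (x , y)) s
    shorter-column = countUpTo-monoˡ _ _ s λ x 1≤x _ kxt →
      kept-closed kxt 1≤x ≤-refl 1≤y y≤t (kept⇒row≢ kxt) y≢q

  topAligned-removedColumn : ∀ {s t} → kept F i j (s , t) ≡ true →
    topAligned F i j (proj₁ (realign F i j (s , t)) , q) ≡ false
  topAligned-removedColumn {s} {t} k
    rewrite countUpTo-none (λ x → kept F i j (x , q)) (bound F) column-removed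
          | ≤ᵇ-zero (realigned-row≥1 k) = ∧-zeroʳ _

  column-rank : ∀ {s t} → kept F i j (s , t) ≡ true → Rank q t (proj₂ (realign F i j (s , t)))
  column-rank {s} {t} k =
    countUpTo-rank (λ y → topAligned F i j (proj₁ (realign F i j (s , t)) , y)) 1≤q (topAligned-removedColumn k) t
      λ y 1≤y y≤t y≢q → topAligned-rowPrefix k 1≤y y≤t y≢q

  realign-inΠ : ∀ {s t} → kept F i j (s , t) ≡ true → inΠ F i j (realign F i j (s , t)) ≡ true
  realign-inΠ {s} {t} k =
    ∧-true (≤⇒≤ᵇ-true (realigned-row≥1 k))
      (∧-true (≤⇒≤ᵇ-true (countUpTo-pos _ 1≤t (topAligned-rowPrefix k 1≤t ≤-refl (kept⇒column≢ k))))
              (≤⇒≤ᵇ-true (countUpTo-monoʳ _ (proj₂ (kept⇒bounded k)))))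
    where
    1≤t : 1 ≤ t
    1≤t = proj₂ (kept⇒pos k)

  realign-nonAttacking : ∀ {s t s' t'} → kept F i j (s , t) ≡ true → kept F i j (s' , t') ≡ true →
    s ≢ s' → t ≢ t' →
    proj₁ (realign F i j (s , t)) ≢ proj₁ (realign F i j (s' , t'))
    × proj₂ (realign F i j (s , t)) ≢ proj₂ (realign F i j (s' , t'))
  realign-nonAttacking k k' s≢s' t≢t' =
    s≢s' ∘ Rank-injective (row-rank k) (row-rank k') (kept⇒row≢ k) (kept⇒row≢ k') ,
    t≢t' ∘ Rank-injective (column-rank k) (column-rank k') (kept⇒column≢ k) (kept⇒column≢ k')

lemma2p9 : (F : Ferrers) (r : ℕ)
    (lab : Fin (suc r) → ℕ × ℕ) (cell : Fin (suc r) → Cell)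
    → (∀ a → diagCell F (proj₁ (lab a)) (proj₂ (lab a)) ≡ just (cell a))
    → (∀ a b → a Fin.< b → lab a <lex lab b)
    → (∀ a b → a ≢ b → (proj₁ (cell a) ≢ proj₁ (cell b)) × (proj₂ (cell a) ≢ proj₂ (cell b)))
    → (∀ (a : Fin r) → kept F (proj₁ (lab (fromℕ r))) (proj₂ (lab (fromℕ r))) (cell (inject₁ a)) ≡ true)
      × (∀ (a : Fin r) → inΠ F (proj₁ (lab (fromℕ r))) (proj₂ (lab (fromℕ r)))
           (realign F (proj₁ (lab (fromℕ r))) (proj₂ (lab (fromℕ r))) (cell (inject₁ a))) ≡ true)
      × (∀ (a b : Fin r) → a ≢ b →
           (proj₁ (realign F (proj₁ (lab (fromℕ r))) (proj₂ (lab (fromℕ r))) (cell (inject₁ a)))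
             ≢ proj₁ (realign F (proj₁ (lab (fromℕ r))) (proj₂ (lab (fromℕ r))) (cell (inject₁ b))))
           × (proj₂ (realign F (proj₁ (lab (fromℕ r))) (proj₂ (lab (fromℕ r))) (cell (inject₁ a)))
             ≢ proj₂ (realign F (proj₁ (lab (fromℕ r))) (proj₂ (lab (fromℕ r))) (cell (inject₁ b)))))
lemma2p9 F r lab cell onDiagonal increasing nonAttacking =
  rook-kept ,
  (λ a → realign-inΠ (rook-kept a)) ,
  λ a b a≢b → uncurry (realign-nonAttacking (rook-kept a) (rook-kept b))
                      (nonAttacking _ _ (a≢b ∘ inject₁-injective))
  where
  open Reduction F (proj₁ (lab (fromℕ r))) (proj₂ (lab (fromℕ r))) (onDiagonal (fromℕ r))

  ≢last : ∀ (a : Fin r) → inject₁ a ≢ fromℕ r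
  ≢last a = fromℕ≢inject₁ ∘ sym

  rook-kept : ∀ (a : Fin r) → kept F (proj₁ (lab (fromℕ r))) (proj₂ (lab (fromℕ r))) (cell (inject₁ a)) ≡ true
  rook-kept a = uncurry (earlier-kept (onDiagonal (inject₁ a))
                                      (increasing _ _ (Finₚ.≤∧≢⇒< (≤fromℕ (inject₁ a)) (≢last a))))
                        (nonAttacking _ _ (≢last a))
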